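{- Let $T$ be an even integer with $T\neq\pm 8$ and put $N=\frac{(T^2+64)(T-8)(T+8)}{16}$. If $(x,y)\in\mathbb{Z}^2$ satisfies $(x+y)^4-4x^2y^2+Txy(x+y)+4=0$, then there exists an integer divisor $d_1$ of $N$ such that $$(4x+4y)^2=d_1+\frac{N}{d_1}-\frac{T^2}{2}.$$ -}

module Defs where

open import Data.Integer using (ℤ; +_; _+_; _-_; _*_; -_)
open import Data.Integer.DivMod using (_/_)

-- N = (T^2+64)(T-8)(T+8)/16 (exact for even T; _/_ is integer division)
N : ℤ → ℤ
N T = ((T * T + + 64) * (T - + 8) * (T + + 8)) / + 16

quartic : ℤ → ℤ → ℤ → ℤ
quartic T x y =
  let s = x + y in
  s * s * s * s - + 4 * (x * x) * (y * y) + T * x * y * s + + 4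

{-# OPTIONS --safe #-}
module Submission where

-- Write T = 2k, s = x + y and p = xy. The two integers
--   d± = 8s² + k² ∓ 16p ± 4ks
-- satisfy the polynomial identity d₋ d₊ = (k² + 16)(k² − 16) + 64·quartic(T, x, y),
-- so on the curve they factor N = (k² + 16)(k − 4)(k + 4), while
-- d₋ + d₊ = 16s² + 2k² = (4x + 4y)² + T²/2.

open import Defs
open import Data.Integer using (ℤ; +_; _+_; _-_; _*_; -_; -[1+_]; _/ℕ_)
open import Data.Integer.DivMod using (_/_; div-pos-is-/ℕ)
open import Data.Integer.Divisibility using (_∣_)
open import Data.Integer.Divisibility.Signed using (divides; ∣ᵤ⇒∣)
open import Data.Integer.Properties using (pos-*; +-identityʳ)
open import Data.Integer.Tactic.RingSolver using (solve-∀)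
open import Data.Product using (_×_; ∃-syntax; _,_)
open import Relation.Binary.PropositionalEquality
open import Data.Nat as ℕ using (ℕ)
import Data.Nat.DivMod as ℕ

i*n/n≡i : ∀ i n .{{_ : ℕ.NonZero n}} → i * + n / + n ≡ i
i*n/n≡i i n@(ℕ.suc _) = trans (div-pos-is-/ℕ (i * + n) n) (i*n/ℕn≡i i)
  where
  i*n/ℕn≡i : ∀ i → i * + n /ℕ n ≡ i
  i*n/ℕn≡i (+ j) rewrite sym (pos-* j n) = cong +_ (ℕ.m*n/n≡m j n)
  i*n/ℕn≡i -[1+ j ] rewrite ℕ.m*n%n≡0 (ℕ.suc j) n {{_}} | ℕ.m*n/n≡m (ℕ.suc j) n {{_}} = refl

2∣⇒≡k*2 : ∀ T → + 2 ∣ T → ∃[ k ] T ≡ k * + 2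
2∣⇒≡k*2 T 2∣T with ∣ᵤ⇒∣ {+ 2} {T} 2∣T
... | divides k T≡k*2 = k , T≡k*2

factor₋ factor₊ : ℤ → ℤ → ℤ → ℤ
factor₋ k x y = + 8 * (x + y) * (x + y) + k * k - + 16 * (x * y) + + 4 * k * (x + y)
factor₊ k x y = + 8 * (x + y) * (x + y) + k * k + + 16 * (x * y) - + 4 * k * (x + y)

factor₋*factor₊ : ∀ k x y → factor₋ k x y * factor₊ k x y
  ≡ (k * k + + 16) * (k - + 4) * (k + + 4) + + 64 * quartic (k * + 2) x y
factor₋*factor₊ = identity
  where
  -- solve-∀ does not unfold factor₋, factor₊ and quartic, so the identity is spelled out.
  identity : ∀ k x y →
    (+ 8 * (x + y) * (x + y) + k * k - + 16 * (x * y) + + 4 * k * (x + y))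
      * (+ 8 * (x + y) * (x + y) + k * k + + 16 * (x * y) - + 4 * k * (x + y))
    ≡ (k * k + + 16) * (k - + 4) * (k + + 4) + + 64 * ((x + y) * (x + y) * (x + y) * (x + y)
      - + 4 * (x * x) * (y * y) + k * + 2 * x * y * (x + y) + + 4)
  identity = solve-∀

factor₋+factor₊ : ∀ k x y → factor₋ k x y + factor₊ k x y
  ≡ (+ 4 * x + + 4 * y) * (+ 4 * x + + 4 * y) + k * k * + 2
factor₋+factor₊ = identity
  where
  identity : ∀ k x y →
    (+ 8 * (x + y) * (x + y) + k * k - + 16 * (x * y) + + 4 * k * (x + y))
      + (+ 8 * (x + y) * (x + y) + k * k + + 16 * (x * y) - + 4 * k * (x + y))
    ≡ (+ 4 * x + + 4 * y) * (+ 4 * x + + 4 * y) + k * k * + 2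
  identity = solve-∀

N-even : ∀ k → N (k * + 2) ≡ (k * k + + 16) * (k - + 4) * (k + + 4)
N-even k = begin
  N (k * + 2)                                           ≡⟨ cong (_/ + 16) (expand k) ⟩
  (k * k + + 16) * (k - + 4) * (k + + 4) * + 16 / + 16  ≡⟨ i*n/n≡i _ 16 ⟩
  (k * k + + 16) * (k - + 4) * (k + + 4)                ∎
  where
  open ≡-Reasoning
  expand : ∀ k → ((k * + 2) * (k * + 2) + + 64) * (k * + 2 - + 8) * (k * + 2 + + 8)
         ≡ (k * k + + 16) * (k - + 4) * (k + + 4) * + 16
  expand = solve-∀

half-square-even : ∀ k → (k * + 2) * (k * + 2) / + 2 ≡ k * k * + 2
half-square-even k = trans (cong (_/ + 2) (double k)) (i*n/n≡i (k * k * + 2) 2)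
  where
  double : ∀ k → (k * + 2) * (k * + 2) ≡ k * k * + 2 * + 2
  double = solve-∀

theorem4p2 : (T : ℤ) → (+ 2) ∣ T → T ≢ + 8 → T ≢ - + 8 →
    (x y : ℤ) → quartic T x y ≡ + 0 →
    ∃[ d₁ ] ∃[ e ] (d₁ * e ≡ N T ×
      (+ 4 * x + + 4 * y) * (+ 4 * x + + 4 * y) ≡ d₁ + e - (T * T) / + 2)
theorem4p2 T 2∣T _ _ x y onCurve with 2∣⇒≡k*2 T 2∣T
... | k , refl = d₋ , d₊ , product , sum
  where
  open ≡-Reasoning
  d₋ d₊ M square : ℤ
  d₋ = factor₋ k x y
  d₊ = factor₊ k x y
  M = (k * k + + 16) * (k - + 4) * (k + + 4)
  square = (+ 4 * x + + 4 * y) * (+ 4 * x + + 4 * y)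

  product : d₋ * d₊ ≡ N (k * + 2)
  product = begin
    d₋ * d₊                           ≡⟨ factor₋*factor₊ k x y ⟩
    M + + 64 * quartic (k * + 2) x y  ≡⟨ cong (λ q → M + + 64 * q) onCurve ⟩
    M + + 0                           ≡⟨ +-identityʳ M ⟩
    M                                 ≡⟨ N-even k ⟨
    N (k * + 2)                       ∎

  sum : square ≡ d₋ + d₊ - (k * + 2) * (k * + 2) / + 2
  sum = begin
    square                              ≡⟨ add-sub square (k * k * + 2) ⟨
    square + k * k * + 2 - k * k * + 2  ≡⟨ cong₂ _-_ (factor₋+factor₊ k x y) (half-square-even k) ⟨
    d₋ + d₊ - (k * + 2) * (k * + 2) / + 2  ∎
    where
    add-sub : ∀ a b → a + b - b ≡ a
    add-sub = solve-∀
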